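{- Let $\mathcal{T}=((t,u),\mathcal{O},\mathcal{R})$ be a tiling with $\mathcal{R}=\{\mathcal{R}_1,\ldots,\mathcal{R}_k\}$, where each requirement list $\mathcal{R}_i$ is a finite set. Let $\ell_i$ be the size of the largest gridded permutation in $\mathcal{R}_i$ and $L=\ell_1+\cdots+\ell_k$. If $\operatorname{Grid}(\mathcal{T})$ is nonempty, then $\operatorname{Grid}(\mathcal{T})$ contains a gridded permutation of size at most $L$.
   Context: A gridded permutation of size $n$ is a pair $(\pi,(c_1,\ldots,c_n))$ with $\pi$ a permutation of $\{1,\ldots,n\}$ and cells $c_i=(x_i,y_i)\in\mathbb{N}^2$, consistent in the sense that $x_i\le x_j$ whenever $i<j$ and $y_i\le y_j$ whenever $\pi(i)<\pi(j)$. $\mathcal{G}^{(t,u)}$ is the set of gridded permutations with all cells in $\{0,\ldots,t-1\}\times\{0,\ldots,u-1\}$. $g=(\pi,(c_1,\ldots,c_n))$ contains $h=(\sigma,(d_1,\ldots,d_k))$ if there are indices $i_1<\cdots<i_k$ with $\pi(i_1)\cdots\pi(i_k)$ order-isomorphic to $\sigma$ and $c_{i_j}=d_j$ for all $j$. A tiling $\mathcal{T}=((t,u),\mathcal{O},\mathcal{R})$ consists of integers $t,u$, a set $\mathcal{O}$ of gridded permutations (obstructions) and a set $\mathcal{R}$ of sets of gridded permutations (requirement lists); $\operatorname{Grid}(\mathcal{T})$ is the set of $g\in\mathcal{G}^{(t,u)}$ avoiding every element of $\mathcal{O}$ and containing at least one element of each requirement list. -}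

module Defs where

open import Data.Nat using (ℕ; _≤_; _<_; _⊔_; _+_)
open import Data.Fin as F using (Fin)
open import Data.Fin.Permutation using (Permutation′; _⟨$⟩ʳ_)
open import Data.Product using (_×_; _,_; proj₁; proj₂; Σ; ∃)
open import Data.List using (List; map; foldr; sum)
open import Data.List.Membership.Propositional using (_∈_)
open import Data.List.Relation.Unary.Any using (Any)
open import Data.Vec.Functional using (Vector)
open import Data.Vec.Functional as VF using ()
open import Function.Bundles using (_⇔_)
open import Relation.Binary.PropositionalEquality using (_≡_)
open import Relation.Nullary using (¬_)

Cell : Set
Cell = ℕ × ℕ

record GriddedPerm : Set where
  field
    size  : ℕ
    perm  : Permutation′ size
    cell  : Fin size → Cell
    consX : ∀ i j → i F.< j → proj₁ (cell i) ≤ proj₁ (cell j)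
    consY : ∀ i j → (perm ⟨$⟩ʳ i) F.< (perm ⟨$⟩ʳ j) → proj₂ (cell i) ≤ proj₂ (cell j)
open GriddedPerm public

Contains : GriddedPerm → GriddedPerm → Set
Contains g h =
  Σ (Fin (size h) → Fin (size g)) λ f →
    (∀ a b → a F.< b → f a F.< f b) ×
    (∀ a b → ((perm h ⟨$⟩ʳ a) F.< (perm h ⟨$⟩ʳ b)) ⇔ ((perm g ⟨$⟩ʳ f a) F.< (perm g ⟨$⟩ʳ f b))) ×
    (∀ a → cell g (f a) ≡ cell h a)

InGrid : ℕ → ℕ → GriddedPerm → Set
InGrid t u g = ∀ i → (proj₁ (cell g i) < t) × (proj₂ (cell g i) < u)

-- A tiling ((t,u), O, R) with R = {R_1,...,R_k}, each R_i finite (given as a list).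
-- Obstructions O are an arbitrary set (predicate) of gridded permutations.
record Tiling : Set₁ where
  field
    t u  : ℕ
    Obs  : GriddedPerm → Set
    k    : ℕ
    Req  : Fin k → List GriddedPerm
open Tiling public

InTiling : Tiling → GriddedPerm → Set
InTiling T g =
  InGrid (t T) (u T) g ×
  (∀ h → Obs T h → ¬ Contains g h) ×
  (∀ i → Any (Contains g) (Req T i))

-- ℓ_i : size of the largest gridded permutation in R_i (0 if R_i is empty)
maxSize : List GriddedPerm → ℕ
maxSize rs = foldr _⊔_ 0 (map size rs)

reqBound : Tiling → ℕ
reqBound T = VF.foldr _+_ 0 (λ i → maxSize (Req T i))

-- If g ∈ Grid(T) has size greater than L, fix one occurrence in g of a
-- pattern from each requirement list.  Together these occurrences use at
-- most L points of g, so some point of g is used by none of them.  Deleting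
-- it keeps every chosen occurrence, cannot create an obstruction (the result
-- is contained in g) and keeps all cells in the grid, so the result is again
-- in Grid(T).  Repeating this reaches size at most L.
module Submission where

open import Defs
open import Data.Nat using (_≤_)
open import Data.Product using (∃; _×_)

open import Data.Nat as ℕ using (ℕ; zero; suc; _+_; _<_)
import Data.Nat.Properties as ℕ
open import Data.Nat.Induction using (<-wellFounded)
open import Data.Fin as F using (Fin; punchIn; punchOut; _↑ˡ_; _↑ʳ_)
open import Data.Fin.Properties
  using (punchIn-mono-≤; punchIn-cancel-≤; punchIn-injective; punchIn-punchOut; ≤∧≢⇒<; <⇒≢; injective⇒≤; ¬∀⟶∃¬; any?; _≟_)
open import Data.Fin.Permutation using (Permutation′; _⟨$⟩ʳ_; remove; punchIn-permute)
open import Data.Product using (_,_; proj₁; proj₂)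
open import Data.List using (_∷_)
open import Data.List.Membership.Propositional using (_∈_; find; lose)
open import Data.List.Relation.Unary.Any using (Any; here; there)
open import Data.Vec.Functional as V using (Vector; _++_)
open import Data.Vec.Functional.Properties using (lookup-++ˡ; lookup-++ʳ)
open import Function using (_∘_; _on_)
open import Function.Bundles using (_⇔_; mk⇔; Equivalence)
open import Function.Construct.Composition using (_⇔-∘_)
open import Function.Construct.Symmetry using (⇔-sym)
open import Induction.WellFounded using (Acc; acc)
open import Relation.Binary.Construct.On as On using ()
open import Relation.Binary.PropositionalEquality
  using (_≡_; _≢_; refl; sym; trans; cong; subst₂)
open import Relation.Nullary using (¬_; yes; no)

punchIn-<⇔ : ∀ {n} (i : Fin (suc n)) {a b : Fin n} → a F.< b ⇔ punchIn i a F.< punchIn i b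
punchIn-<⇔ i {a} {b} = mk⇔
  (λ a<b → ≤∧≢⇒< (punchIn-mono-≤ i a b (ℕ.<⇒≤ a<b)) (<⇒≢ a<b ∘ punchIn-injective i a b))
  (λ lt → ≤∧≢⇒< (punchIn-cancel-≤ i a b (ℕ.<⇒≤ lt)) (<⇒≢ lt ∘ cong (punchIn i)))

remove-<⇔ : ∀ {m} (π : Permutation′ (suc m)) (j : Fin (suc m)) {a b : Fin m} →
  (remove j π ⟨$⟩ʳ a) F.< (remove j π ⟨$⟩ʳ b) ⇔ (π ⟨$⟩ʳ punchIn j a) F.< (π ⟨$⟩ʳ punchIn j b)
remove-<⇔ π j {a} {b} = subst₂ (λ x y → (remove j π ⟨$⟩ʳ a) F.< (remove j π ⟨$⟩ʳ b) ⇔ x F.< y)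
  (sym (punchIn-permute π j a)) (sym (punchIn-permute π j b)) (punchIn-<⇔ (π ⟨$⟩ʳ j))

Contains-trans : ∀ {g h k} → Contains g h → Contains h k → Contains g k
Contains-trans (f , f-mono , f-order , f-cell) (e , e-mono , e-order , e-cell) =
  f ∘ e ,
  (λ a b → f-mono (e a) (e b) ∘ e-mono a b) ,
  (λ a b → f-order (e a) (e b) ⇔-∘ e-order a b) ,
  (λ a → trans (f-cell (e a)) (e-cell a))

delete : (g : GriddedPerm) → Fin (size g) → GriddedPerm
delete record { size = suc m ; perm = π ; cell = c ; consX = cx ; consY = cy } j = record
  { size  = m
  ; perm  = remove j π
  ; cell  = c ∘ punchIn j
  ; consX = λ a b → cx (punchIn j a) (punchIn j b) ∘ Equivalence.to (punchIn-<⇔ j)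
  ; consY = λ a b → cy (punchIn j a) (punchIn j b) ∘ Equivalence.to (remove-<⇔ π j)
  }

size-delete< : ∀ g j → size (delete g j) < size g
size-delete< record { size = suc m } j = ℕ.n<1+n m

InGrid-delete : ∀ {t u} g j → InGrid t u g → InGrid t u (delete g j)
InGrid-delete record { size = suc m } j g∈G = g∈G ∘ punchIn j

contains-delete : ∀ g j → Contains g (delete g j)
contains-delete record { size = suc m ; perm = π } j =
  punchIn j , (λ a b → Equivalence.to (punchIn-<⇔ j)) , (λ a b → remove-<⇔ π j) , (λ a → refl)

delete-contains : ∀ g j {h} (h⊆g : Contains g h) → (∀ a → proj₁ h⊆g a ≢ j) → Contains (delete g j) h
delete-contains record { size = suc m ; perm = π ; cell = c } j {h} (f , f-mono , f-order , f-cell) unused =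
  f′ , f′-mono , f′-order , (λ a → trans (cong c (punchIn-f′ a)) (f-cell a))
  where
  f′ : Fin (size h) → Fin m
  f′ a = punchOut (unused a ∘ sym)

  punchIn-f′ : ∀ a → punchIn j (f′ a) ≡ f a
  punchIn-f′ a = punchIn-punchOut (unused a ∘ sym)

  f′-mono : ∀ a b → a F.< b → f′ a F.< f′ b
  f′-mono a b a<b = Equivalence.from (punchIn-<⇔ j)
    (subst₂ F._<_ (sym (punchIn-f′ a)) (sym (punchIn-f′ b)) (f-mono a b a<b))

  f′-order : ∀ a b → (perm h ⟨$⟩ʳ a) F.< (perm h ⟨$⟩ʳ b) ⇔ (remove j π ⟨$⟩ʳ f′ a) F.< (remove j π ⟨$⟩ʳ f′ b)
  f′-order a b = ⇔-sym (remove-<⇔ π j) ⇔-∘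
    subst₂ (λ x y → (perm h ⟨$⟩ʳ a) F.< (perm h ⟨$⟩ʳ b) ⇔ (π ⟨$⟩ʳ x) F.< (π ⟨$⟩ʳ y)) (sym (punchIn-f′ a)) (sym (punchIn-f′ b)) (f-order a b)

<⇒∃-not-in-image : ∀ {m n} → m < n → (f : Fin m → Fin n) → ∃ λ j → ∀ x → f x ≢ j
<⇒∃-not-in-image {m} {n} m<n f =
  let j , not-hit = ¬∀⟶∃¬ n (λ j → ∃ λ x → f x ≡ j) (λ j → any? λ x → f x ≟ j) not-surjective
  in  j , λ x fx≡j → not-hit (x , fx≡j)
  where
  not-surjective : ¬ (∀ j → ∃ λ x → f x ≡ j)
  not-surjective surj = ℕ.<⇒≱ m<n (injective⇒≤ {f = proj₁ ∘ surj}
    (λ {j} {j′} eq → trans (sym (proj₂ (surj j))) (trans (cong f eq) (proj₂ (surj j′)))))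

foldr-+-mono-≤ : ∀ {k} {s t : Vector ℕ k} → (∀ i → s i ≤ t i) → V.foldr _+_ 0 s ≤ V.foldr _+_ 0 t
foldr-+-mono-≤ {zero}  s≤t = ℕ.z≤n
foldr-+-mono-≤ {suc k} s≤t = ℕ.+-mono-≤ (s≤t F.zero) (foldr-+-mono-≤ (s≤t ∘ F.suc))

concatFamily : ∀ {A : Set} {k} (s : Vector ℕ k) → ((i : Fin k) → Vector A (s i)) → Vector A (V.foldr _+_ 0 s)
concatFamily {k = zero}  s xs = V.[]
concatFamily {k = suc k} s xs = xs F.zero ++ concatFamily (s ∘ F.suc) (xs ∘ F.suc)

concatFamily-hits : ∀ {A : Set} {k} (s : Vector ℕ k) (xs : (i : Fin k) → Vector A (s i)) i a →
  ∃ λ x → concatFamily s xs x ≡ xs i a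
concatFamily-hits s xs F.zero a = a ↑ˡ _ , lookup-++ˡ (xs F.zero) _ a
concatFamily-hits s xs (F.suc i) a =
  let x , hit = concatFamily-hits (s ∘ F.suc) (xs ∘ F.suc) i a
  in  s F.zero ↑ʳ x , trans (lookup-++ʳ (xs F.zero) _ x) hit

∈⇒size≤maxSize : ∀ {h rs} → h ∈ rs → size h ≤ maxSize rs
∈⇒size≤maxSize {rs = r ∷ rs} (here refl) = ℕ.m≤m⊔n (size r) (maxSize rs)
∈⇒size≤maxSize {rs = r ∷ rs} (there h∈rs) = ℕ.m≤n⇒m≤o⊔n (size r) (∈⇒size≤maxSize h∈rs)

module _ (T : Tiling) where

  delete-InTiling : ∀ {g} → InTiling T g → ∀ j →
    (∀ i → Any (Contains (delete g j)) (Req T i)) → InTiling T (delete g j)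
  delete-InTiling {g} (g∈G , avoids , _) j meets =
    InGrid-delete g j g∈G ,
    (λ h o h⊆g′ → avoids h o (Contains-trans {g} {delete g j} {h} (contains-delete g j) h⊆g′)) ,
    meets

  requirements-survive-deletion : ∀ {g} → InTiling T g → reqBound T < size g →
    ∃ λ j → ∀ i → Any (Contains (delete g j)) (Req T i)
  requirements-survive-deletion {g} (_ , _ , meets) L<size = j , meets′
    where
    occurrence : ∀ i → ∃ λ h → h ∈ Req T i × Contains g h
    occurrence i = find (meets i)

    patternSize : Vector ℕ (k T)
    patternSize i = size (proj₁ (occurrence i))

    embedding : (i : Fin (k T)) → Fin (patternSize i) → Fin (size g)
    embedding i = proj₁ (proj₂ (proj₂ (occurrence i)))

    used : Fin (V.foldr _+_ 0 patternSize) → Fin (size g)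
    used = concatFamily patternSize embedding

    #used≤L : V.foldr _+_ 0 patternSize ≤ reqBound T
    #used≤L = foldr-+-mono-≤ (λ i → ∈⇒size≤maxSize (proj₁ (proj₂ (occurrence i))))

    unusedPoint : ∃ λ j → ∀ x → used x ≢ j
    unusedPoint = <⇒∃-not-in-image (ℕ.≤-<-trans #used≤L L<size) used

    j : Fin (size g)
    j = proj₁ unusedPoint

    meets′ : ∀ i → Any (Contains (delete g j)) (Req T i)
    meets′ i =
      let h , h∈Req , h⊆g = occurrence i
      in  lose h∈Req (delete-contains g j {h} h⊆g λ a hits-j →
            let x , x↦a = concatFamily-hits patternSize embedding i a
            in  proj₂ unusedPoint x (trans x↦a hits-j))

  shrink : ∀ g → Acc (_<_ on size) g → InTiling T g → ∃ λ g′ → InTiling T g′ × size g′ ≤ reqBound T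
  shrink g (acc smaller) g∈T with size g ℕ.≤? reqBound T
  ... | yes size≤L = g , g∈T , size≤L
  ... | no  size≰L =
    let j , meets = requirements-survive-deletion g∈T (ℕ.≰⇒> size≰L)
    in  shrink (delete g j) (smaller (size-delete< g j)) (delete-InTiling g∈T j meets)

theorem6p3 : (T : Tiling) → ∃ (InTiling T) →
    ∃ (λ g → InTiling T g × size g ≤ reqBound T)
theorem6p3 T (g , g∈T) = shrink T g (On.wellFounded size <-wellFounded g) g∈T
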